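{- Let $k\ge 6$ and let $G_k$ be the graph defined in the context. For integers $x,y$, there exists a $k$-$L(2,1)$-labelling $L$ of $G_k$ with $L(u)=k$, $L(v)=0$, $L(a_v)=x$, $L(a_u)=y$ if and only if $(x,y)=(k-1,1)$.
   Context: A $k$-$L(2,1)$-labelling of a graph is a map $L$ from its vertices to $\{0,\dots,k\}$ such that adjacent vertices get labels differing by at least $2$ and vertices at distance $2$ get distinct labels. Let $H'$ be the graph with vertices $c,d,e,f_1,\dots,f_{k-3},g,h,i$ and edges $cd,de,hg,gi$ and $gf_j,df_j$ for $j=1,\dots,k-3$. $G_k$ consists of the path $u,a_u,a_v,v$, vertices $b_1,\dots,b_{k-5}$ each adjacent to both $a_u$ and $a_v$, and, for each $i=1,\dots,k-5$, two disjoint copies of $H'$ whose vertex $c$ is joined to $b_i$. -}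

module Defs where

open import Data.Nat using (ℕ; _∸_; _≤_; _+_)
open import Data.Fin using (Fin)
open import Data.Bool using (Bool)
open import Data.Product using (Σ; _×_)
open import Data.Sum using (_⊎_)
open import Relation.Nullary using (¬_)
open import Relation.Binary.PropositionalEquality using (_≡_; _≢_)

data HV (k : ℕ) : Set where
  hc hd he : HV k
  hf : Fin (k ∸ 3) → HV k
  hg hh hi : HV k

-- Edges of H' (each undirected edge listed once): cd, de, hg, gi, g f_j, d f_j
data HE {k : ℕ} : HV k → HV k → Set where
  cd : HE hc hd
  de : HE hd he
  hg : HE hh hg
  gi : HE hg hi
  gf : (j : Fin (k ∸ 3)) → HE hg (hf j)
  df : (j : Fin (k ∸ 3)) → HE hd (hf j)

-- Vertices of G_k: u, a_u, a_v, v, b_1..b_{k-5}, and for each i two copies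
-- (indexed by Bool) of H'
data V (k : ℕ) : Set where
  u au av v : V k
  b : Fin (k ∸ 5) → V k
  cp : Fin (k ∸ 5) → Bool → HV k → V k

-- Edges of G_k (each undirected edge listed once)
data E {k : ℕ} : V k → V k → Set where
  u-au  : E u au
  au-av : E au av
  av-v  : E av v
  b-au  : (i : Fin (k ∸ 5)) → E (b i) au
  b-av  : (i : Fin (k ∸ 5)) → E (b i) av
  b-c   : (i : Fin (k ∸ 5)) (s : Bool) → E (b i) (cp i s hc)
  inH   : (i : Fin (k ∸ 5)) (s : Bool) {x y : HV k} → HE x y → E (cp i s x) (cp i s y)

Adj : {k : ℕ} → V k → V k → Set
Adj x y = E x y ⊎ E y x

Dist2 : {k : ℕ} → V k → V k → Set
Dist2 {k} x y = x ≢ y × ¬ Adj x y × Σ (V k) (λ z → Adj x z × Adj z y)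

Diff≥2 : ℕ → ℕ → Set
Diff≥2 m n = (2 + m ≤ n) ⊎ (2 + n ≤ m)

IsL21 : (k : ℕ) → (V k → ℕ) → Set
IsL21 k L =
  ((x : V k) → L x ≤ k) ×
  ((x y : V k) → Adj x y → Diff≥2 (L x) (L y)) ×
  ((x y : V k) → Dist2 x y → L x ≢ L y)

-- Everything rests on one counting fact, the pigeonhole principle with gaps
-- (injective-with-gaps): injective labels in {0, …, N-1} that also miss r
-- other values number at most N - r.  Applied to the k-1 neighbours of d and
-- of g in a copy of H', it forces L(d), L(g) ∈ {0, k} (crowded-endpoint), so
-- the f_j are squeezed into {2, …, k-2} and c gets an extreme label in
-- {0, 1, k-1, k} (Labelling.Gadget.c-extreme).  Since the two c's at b_i
-- differ and avoid L(a_u), L(a_v), the b_i cannot take the labels k-1 (when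
-- L(a_u) = 1) or 1 (when L(a_v) = k-1).  Collecting these facts in
-- HubConstraints, the k-5 distinct labels of the b_i leave room for
-- (L(a_u), L(a_v)) = (1, k-1) only (hub-forced); every other position
-- excludes seven values.
module Submission where

open import Defs
open import Data.Nat using (ℕ; zero; suc; _+_; _≤_; _<_; _≤?_; _≟_; z≤n; s≤s; _∸_)
open import Data.Nat.Properties
open import Data.Integer using (ℤ; +_)
open import Data.Fin using (Fin; zero; suc; toℕ; fromℕ<)
import Data.Fin.Properties as Fin
open import Data.Vec.Functional using () renaming (_∷_ to _◂_)
open import Data.Bool using (Bool; true; false)
open import Data.List using (List; []; _∷_; _++_; [_]; length)
open import Data.List.Relation.Unary.All as All using (All; []; _∷_)
open import Data.List.Relation.Unary.All.Properties using (++⁻)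
open import Data.List.Relation.Unary.Linked using (Linked; [-]; _∷_; tail)
open import Data.List.Relation.Unary.Linked.Properties using (Linked⇒All)
open import Data.Product using (Σ; _×_; _,_; proj₁; proj₂)
open import Data.Sum using (_⊎_; inj₁; inj₂)
import Data.Sum as Sum
open import Data.Empty using (⊥; ⊥-elim)
open import Relation.Nullary using (yes; no; contradiction)
open import Relation.Binary.PropositionalEquality using (_≡_; _≢_; refl; sym; trans; cong; subst; module ≡-Reasoning)
open import Function using (_∘_)
open import Function.Bundles using (_⇔_; mk⇔)
open import Function.Definitions using (Injective)

Avoids : ∀ {a} {A : Set a} {m} → (Fin m → A) → A → Set a
Avoids f t = ∀ i → f i ≢ t

◂-injective : ∀ {a} {A : Set a} {m} {x : A} {f : Fin m → A} →
              Avoids f x → Injective _≡_ _≡_ f → Injective _≡_ _≡_ (x ◂ f)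
◂-injective x∉f inj {zero}  {zero}  _  = refl
◂-injective x∉f inj {zero}  {suc j} eq = ⊥-elim (x∉f j (sym eq))
◂-injective x∉f inj {suc i} {zero}  eq = ⊥-elim (x∉f i eq)
◂-injective x∉f inj {suc i} {suc j} eq = cong suc (inj eq)

injective⇒≤ : ∀ {m N} {f : Fin m → ℕ} → Injective _≡_ _≡_ f → (∀ i → f i < N) → m ≤ N
injective⇒≤ {f = f} inj f<N = Fin.injective⇒≤ {f = λ i → fromℕ< (f<N i)} λ {i} {j} eq → inj (begin
  f i                    ≡⟨ sym (Fin.toℕ-fromℕ< (f<N i)) ⟩
  toℕ (fromℕ< (f<N i))  ≡⟨ cong toℕ eq ⟩
  toℕ (fromℕ< (f<N j))  ≡⟨ Fin.toℕ-fromℕ< (f<N j) ⟩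
  f j                    ∎)
  where open ≡-Reasoning

ascending⇒below : ∀ {x ys} → Linked _<_ (x ∷ ys) → All (x <_) ys
ascending⇒below [-]          = []
ascending⇒below (x<y ∷ rest) = Linked⇒All <-trans x<y rest

-- Induction on xs: the least missed value can be prepended to the injection.
injective-with-gaps : ∀ {m N} (f : Fin m → ℕ) → Injective _≡_ _≡_ f → (∀ i → f i < N) →
                      (xs : List ℕ) → Linked _<_ (xs ++ [ N ]) → All (Avoids f) xs →
                      m + length xs ≤ N
injective-with-gaps {m} f inj f<N [] _ [] = subst (_≤ _) (sym (+-identityʳ m)) (injective⇒≤ inj f<N)
injective-with-gaps {m} {N} f inj f<N (x ∷ xs) chain (x∉f ∷ xs∉f) =
  subst (_≤ N) (sym (+-suc m (length xs)))
    (injective-with-gaps (x ◂ f) (◂-injective x∉f inj) bounded xs (tail chain) (All.zipWith extend (x<xs , xs∉f)))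
  where
  x<xs : All (x <_) xs
  x<xs = proj₁ (++⁻ xs (ascending⇒below chain))
  x<N : x < N
  x<N = All.head (proj₂ (++⁻ xs (ascending⇒below chain)))
  bounded : ∀ i → (x ◂ f) i < N
  bounded zero    = x<N
  bounded (suc i) = f<N i
  extend : ∀ {y} → x < y × Avoids f y → Avoids (x ◂ f) y
  extend (x<y , y∉f) zero    = <⇒≢ x<y
  extend (x<y , y∉f) (suc i) = y∉f i

gaps-overflow : ∀ {m N} (f : Fin m → ℕ) → Injective _≡_ _≡_ f → (∀ i → f i < N) →
                (xs : List ℕ) → Linked _<_ (xs ++ [ N ]) → All (Avoids f) xs →
                N < m + length xs → ⊥
gaps-overflow f inj f<N xs chain xs∉f overfull = <⇒≱ overfull (injective-with-gaps f inj f<N xs chain xs∉f)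

Diff≥2⇒≢ : ∀ {x y} → Diff≥2 x y → x ≢ y
Diff≥2⇒≢ (inj₁ 2+x≤x) refl = 1+n≰n (≤-trans (n≤1+n _) 2+x≤x)
Diff≥2⇒≢ (inj₂ 2+x≤x) refl = 1+n≰n (≤-trans (n≤1+n _) 2+x≤x)

Diff≥2⇒≢suc : ∀ {x y} → Diff≥2 x y → x ≢ suc y
Diff≥2⇒≢suc (inj₁ 2+x≤x-1) refl = 1+n≰n (≤-trans (n≤1+n _) (≤-trans (n≤1+n _) 2+x≤x-1))
Diff≥2⇒≢suc (inj₂ 2+y≤1+y) refl = 1+n≰n 2+y≤1+y

Diff≥2⇒≢pred : ∀ {x y} → Diff≥2 x (suc y) → x ≢ y
Diff≥2⇒≢pred (inj₁ 2+x≤1+x) refl = 1+n≰n 2+x≤1+x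
Diff≥2⇒≢pred (inj₂ 3+x≤x)   refl = 1+n≰n (≤-trans (n≤1+n _) (≤-trans (n≤1+n _) 3+x≤x))

Diff≥2-from-0 : ∀ {x} → Diff≥2 0 x → 2 ≤ x
Diff≥2-from-0 (inj₁ 2≤x) = 2≤x

Diff≥2-from-top : ∀ m {x} → Diff≥2 (2 + m) x → x ≤ 2 + m → x ≤ m
Diff≥2-from-top m (inj₁ 4+m≤x) x≤2+m = ⊥-elim (<⇒≱ 4+m≤x (≤-trans x≤2+m (n≤1+n _)))
Diff≥2-from-top m (inj₂ (s≤s (s≤s x≤m))) _ = x≤m

-- A vertex whose m+1 neighbours carry distinct labels in {0, …, m+2}
-- is itself labelled 0 or m+2: an inner label z would exclude the three
-- further values z-1, z, z+1, leaving only m labels for the neighbours.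
crowded-endpoint : ∀ {m z} (G : Fin (suc m) → ℕ) → Injective _≡_ _≡_ G →
                   (∀ j → G j ≤ 2 + m) → (∀ j → Diff≥2 (G j) z) → z ≤ 2 + m →
                   z ≡ 0 ⊎ z ≡ 2 + m
crowded-endpoint {z = zero} _ _ _ _ _ = inj₁ refl
crowded-endpoint {m} {suc z} G inj G≤ far z≤ with suc z ≟ 2 + m
... | yes top = inj₂ top
... | no ¬top = ⊥-elim (gaps-overflow G inj (s≤s ∘ G≤) (z ∷ suc z ∷ suc (suc z) ∷ [])
                  (≤-refl ∷ ≤-refl ∷ s≤s (≤∧≢⇒< z≤ ¬top) ∷ [-])
                  ((Diff≥2⇒≢pred ∘ far) ∷ (Diff≥2⇒≢ ∘ far) ∷ (Diff≥2⇒≢suc ∘ far) ∷ [])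
                  (≤-reflexive (+-comm 3 (suc m))))

crowded-middle : ∀ {m} (G : Fin (suc m) → ℕ) → Injective _≡_ _≡_ G →
                 (∀ j → 2 ≤ G j) → (∀ j → G j ≤ suc m) → ⊥
crowded-middle {m} G inj 2≤G G≤ = gaps-overflow G inj (s≤s ∘ G≤) (0 ∷ 1 ∷ [])
  (s≤s z≤n ∷ s≤s (s≤s z≤n) ∷ [-])
  ((λ j → >⇒≢ (≤-trans (s≤s z≤n) (2≤G j))) ∷ (λ j → >⇒≢ (2≤G j)) ∷ [])
  (≤-reflexive (+-comm 2 (suc m)))

-- The constraints that a labelling of G_k (k = 6 + n) with L(u) = k and
-- L(v) = 0 imposes on a = L(a_u), w = L(a_v) and B i = L(b_i).  The last two
-- fields are where the gadgets H' enter (see a≡1⇒b≢k-1 and w≡k-1⇒b≢1 below).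
record HubConstraints (n a w : ℕ) (B : Fin (suc n) → ℕ) : Set where
  field
    B-injective    : Injective _≡_ _≡_ B
    B-bounded      : ∀ i → B i ≤ 6 + n
    B-avoids-0     : Avoids B 0
    B-avoids-k     : Avoids B (6 + n)
    B-far-a        : ∀ i → Diff≥2 (B i) a
    B-far-w        : ∀ i → Diff≥2 (B i) w
    a-far-w        : Diff≥2 a w
    1≤a            : 1 ≤ a
    a≤k-2          : a ≤ 4 + n
    2≤w            : 2 ≤ w
    w≤k-1          : w ≤ 5 + n
    a≡1⇒avoids-k-1 : a ≡ 1 → Avoids B (5 + n)
    w≡k-1⇒avoids-1 : w ≡ 5 + n → Avoids B 1

seven-gaps : ∀ {n} {B : Fin (suc n) → ℕ} → Injective _≡_ _≡_ B → (∀ i → B i ≤ 6 + n) →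
             (xs : List ℕ) → Linked _<_ (xs ++ [ 7 + n ]) → All (Avoids B) xs → 7 ≤ length xs → ⊥
seven-gaps {n} inj B≤ xs chain gaps 7≤|xs| = gaps-overflow _ inj (s≤s ∘ B≤) xs chain gaps
  (≤-trans (≤-reflexive (+-comm 7 (suc n))) (+-monoʳ-≤ (suc n) 7≤|xs|))

-- w < a: B misses 0, w-1, w, a-1, a, a+1, k.
hub-descending : ∀ {n a w B} → HubConstraints n a w B → 2 + w ≤ a → ⊥
hub-descending {w = zero} h _ = contradiction (HubConstraints.2≤w h) λ ()
hub-descending {n} {suc a} {suc w} h (s≤s w+1<a) = seven-gaps B-injective B-bounded
  (0 ∷ w ∷ suc w ∷ a ∷ suc a ∷ suc (suc a) ∷ 6 + n ∷ [])
  (≤-pred 2≤w ∷ ≤-refl ∷ w+1<a ∷ ≤-refl ∷ ≤-refl ∷ s≤s (s≤s a≤k-2) ∷ ≤-refl ∷ [-])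
  (B-avoids-0 ∷ Diff≥2⇒≢pred ∘ B-far-w ∷ Diff≥2⇒≢ ∘ B-far-w ∷
   Diff≥2⇒≢pred ∘ B-far-a ∷ Diff≥2⇒≢ ∘ B-far-a ∷ Diff≥2⇒≢suc ∘ B-far-a ∷ B-avoids-k ∷ [])
  ≤-refl
  where open HubConstraints h

-- a = 1 < w < k-1: B misses 0, 1, 2, k (always), k-1 (gadgets), and w-1, w
-- if w = k-2, or w, w+1 otherwise.
hub-a≡1 : ∀ {n w B} → HubConstraints n 1 w B → 3 ≤ w → w ≢ 5 + n → ⊥
hub-a≡1 {n} {w} h 3≤w w≢k-1 with w ≟ 4 + n
... | yes refl = seven-gaps B-injective B-bounded
  (0 ∷ 1 ∷ 2 ∷ 3 + n ∷ 4 + n ∷ 5 + n ∷ 6 + n ∷ [])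
  (s≤s z≤n ∷ s≤s (s≤s z≤n) ∷ s≤s (s≤s (s≤s z≤n)) ∷ ≤-refl ∷ ≤-refl ∷ ≤-refl ∷ ≤-refl ∷ [-])
  (B-avoids-0 ∷ Diff≥2⇒≢ ∘ B-far-a ∷ Diff≥2⇒≢suc ∘ B-far-a ∷
   Diff≥2⇒≢pred ∘ B-far-w ∷ Diff≥2⇒≢ ∘ B-far-w ∷ a≡1⇒avoids-k-1 refl ∷ B-avoids-k ∷ [])
  ≤-refl
  where open HubConstraints h
... | no w≢k-2 = seven-gaps B-injective B-bounded
  (0 ∷ 1 ∷ 2 ∷ w ∷ suc w ∷ 5 + n ∷ 6 + n ∷ [])
  (s≤s z≤n ∷ s≤s (s≤s z≤n) ∷ 3≤w ∷ ≤-refl ∷ s≤s (≤∧≢⇒< (≤-pred (≤∧≢⇒< w≤k-1 w≢k-1)) w≢k-2) ∷ ≤-refl ∷ ≤-refl ∷ [-])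
  (B-avoids-0 ∷ Diff≥2⇒≢ ∘ B-far-a ∷ Diff≥2⇒≢suc ∘ B-far-a ∷
   Diff≥2⇒≢ ∘ B-far-w ∷ Diff≥2⇒≢suc ∘ B-far-w ∷ a≡1⇒avoids-k-1 refl ∷ B-avoids-k ∷ [])
  ≤-refl
  where open HubConstraints h

-- 1 < a < w = k-1: B misses 0, k-1, k, a-1, a, a+1, and k-2 if a = 2 or
-- 1 (gadgets) otherwise.
hub-w≡k-1 : ∀ {n a B} → HubConstraints n (2 + a) (5 + n) B → 4 + a ≤ 5 + n → ⊥
hub-w≡k-1 {n} {zero} h _ = seven-gaps B-injective B-bounded
  (0 ∷ 1 ∷ 2 ∷ 3 ∷ 4 + n ∷ 5 + n ∷ 6 + n ∷ [])
  (s≤s z≤n ∷ s≤s (s≤s z≤n) ∷ ≤-refl ∷ s≤s (s≤s (s≤s (s≤s z≤n))) ∷ ≤-refl ∷ ≤-refl ∷ ≤-refl ∷ [-])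
  (B-avoids-0 ∷ Diff≥2⇒≢pred ∘ B-far-a ∷ Diff≥2⇒≢ ∘ B-far-a ∷ Diff≥2⇒≢suc ∘ B-far-a ∷
   Diff≥2⇒≢pred ∘ B-far-w ∷ Diff≥2⇒≢ ∘ B-far-w ∷ B-avoids-k ∷ [])
  ≤-refl
  where open HubConstraints h
hub-w≡k-1 {n} {suc a} h a+2<k-1 = seven-gaps B-injective B-bounded
  (0 ∷ 1 ∷ 2 + a ∷ 3 + a ∷ 4 + a ∷ 5 + n ∷ 6 + n ∷ [])
  (s≤s z≤n ∷ s≤s (s≤s z≤n) ∷ ≤-refl ∷ ≤-refl ∷ a+2<k-1 ∷ ≤-refl ∷ ≤-refl ∷ [-])
  (B-avoids-0 ∷ w≡k-1⇒avoids-1 refl ∷ Diff≥2⇒≢pred ∘ B-far-a ∷ Diff≥2⇒≢ ∘ B-far-a ∷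
   Diff≥2⇒≢suc ∘ B-far-a ∷ Diff≥2⇒≢ ∘ B-far-w ∷ B-avoids-k ∷ [])
  ≤-refl
  where open HubConstraints h

-- 1 < a < w < k-1: B misses 0, a-1, a, a+1, w, w+1, k.
hub-inner : ∀ {n a w B} → HubConstraints n (2 + a) w B → 4 + a ≤ w → w ≢ 5 + n → ⊥
hub-inner {n} {a} {w} h a+2<w w≢k-1 = seven-gaps B-injective B-bounded
  (0 ∷ 1 + a ∷ 2 + a ∷ 3 + a ∷ w ∷ suc w ∷ 6 + n ∷ [])
  (s≤s z≤n ∷ ≤-refl ∷ ≤-refl ∷ a+2<w ∷ ≤-refl ∷ s≤s (≤∧≢⇒< w≤k-1 w≢k-1) ∷ ≤-refl ∷ [-])
  (B-avoids-0 ∷ Diff≥2⇒≢pred ∘ B-far-a ∷ Diff≥2⇒≢ ∘ B-far-a ∷ Diff≥2⇒≢suc ∘ B-far-a ∷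
   Diff≥2⇒≢ ∘ B-far-w ∷ Diff≥2⇒≢suc ∘ B-far-w ∷ B-avoids-k ∷ [])
  ≤-refl
  where open HubConstraints h

hub-ascending : ∀ {n a w B} → HubConstraints n a w B → 2 + a ≤ w → a ≡ 1 × w ≡ 5 + n
hub-ascending {a = zero} h _ = contradiction (HubConstraints.1≤a h) λ ()
hub-ascending {n} {suc zero} {w} h 3≤w with w ≟ 5 + n
... | yes w≡k-1 = refl , w≡k-1
... | no  w≢k-1 = ⊥-elim (hub-a≡1 h 3≤w w≢k-1)
hub-ascending {n} {suc (suc a)} {w} h a+2<w with w ≟ 5 + n
... | yes refl  = ⊥-elim (hub-w≡k-1 h a+2<w)
... | no  w≢k-1 = ⊥-elim (hub-inner h a+2<w w≢k-1)

hub-forced : ∀ {n a w B} → HubConstraints n a w B → a ≡ 1 × w ≡ 5 + n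
hub-forced h with HubConstraints.a-far-w h
... | inj₁ a+2≤w = hub-ascending h a+2≤w
... | inj₂ w+2≤a = ⊥-elim (hub-descending h w+2≤a)

Extreme : ℕ → ℕ → Set
Extreme n c = c ≤ 1 ⊎ 5 + n ≤ c

extreme-near-k-1 : ∀ {n c} → Extreme n c → c ≤ 6 + n → c ≢ 1 → Diff≥2 (5 + n) c → c ≡ 0
extreme-near-k-1 {c = zero}        _                _   _   _                 = refl
extreme-near-k-1 {c = suc zero}    _                _   c≢1 _                 = ⊥-elim (c≢1 refl)
extreme-near-k-1 {c = suc (suc c)} (inj₁ (s≤s ()))  _   _   _
extreme-near-k-1                   (inj₂ _)         c≤k _   (inj₁ k+1≤c)      = ⊥-elim (<⇒≱ k+1≤c c≤k)
extreme-near-k-1                   (inj₂ k-1≤c)     _   _   (inj₂ c+2≤k-1)    =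
  ⊥-elim (1+n≰n (≤-trans (n≤1+n _) (≤-trans c+2≤k-1 k-1≤c)))

extreme-near-1 : ∀ {n c} → Extreme n c → c ≤ 6 + n → c ≢ 5 + n → Diff≥2 1 c → c ≡ 6 + n
extreme-near-1 (inj₁ c≤1)   _   _      (inj₁ 3≤c)       = ⊥-elim (<⇒≱ (≤-trans (s≤s (s≤s z≤n)) 3≤c) c≤1)
extreme-near-1 (inj₂ k-1≤c) c≤k c≢k-1 (inj₁ _)          = ≤-antisym c≤k (≤∧≢⇒< k-1≤c (c≢k-1 ∘ sym))
extreme-near-1 _            _   _      (inj₂ (s≤s ()))

module Labelling (n : ℕ) (L : V (6 + n) → ℕ) (isL : IsL21 (6 + n) L) where

  bounded : ∀ x → L x ≤ 6 + n
  bounded = proj₁ isL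

  separated : ∀ {x y} → Adj x y → Diff≥2 (L x) (L y)
  separated = proj₁ (proj₂ isL) _ _

  -- Distinct vertices with a common neighbour get distinct labels.  They need
  -- not be checked for non-adjacency: adjacent vertices differ anyway.
  neighbours-distinct : ∀ {x y z} → Adj x z → Adj y z → x ≢ y → L x ≢ L y
  neighbours-distinct {x} {y} {z} xz yz x≢y Lx≡Ly =
    proj₂ (proj₂ isL) x y (x≢y , (λ xy → Diff≥2⇒≢ (separated xy) Lx≡Ly) , z , xz , Sum.swap yz) Lx≡Ly

  neighbours-injective : ∀ {m z} (ν : Fin m → V (6 + n)) → (∀ j → Adj (ν j) z) →
                         Injective _≡_ _≡_ ν → Injective _≡_ _≡_ (L ∘ ν)
  neighbours-injective ν adj inj {j} {j′} eq with j Fin.≟ j′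
  ... | yes j≡j′ = j≡j′
  ... | no  j≢j′ = ⊥-elim (neighbours-distinct (adj j) (adj j′) (j≢j′ ∘ inj) eq)

  crowded-pole : ∀ {z} (ν : Fin (5 + n) → V (6 + n)) → (∀ j → Adj (ν j) z) →
                 Injective _≡_ _≡_ ν → L z ≡ 0 ⊎ L z ≡ 6 + n
  crowded-pole ν adj inj = crowded-endpoint (L ∘ ν) (neighbours-injective ν adj inj)
    (bounded ∘ ν) (λ j → separated (adj j)) (bounded _)

  next-to-0 : ∀ {x y} → Adj x y → L x ≡ 0 → 2 ≤ L y
  next-to-0 {y = y} xy Lx≡0 = Diff≥2-from-0 (subst (λ t → Diff≥2 t (L y)) Lx≡0 (separated xy))

  next-to-k : ∀ {x y} → Adj x y → L x ≡ 6 + n → L y ≤ 4 + n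
  next-to-k {y = y} xy Lx≡k = Diff≥2-from-top (4 + n) (subst (λ t → Diff≥2 t (L y)) Lx≡k (separated xy)) (bounded _)

  module Gadget (i : Fin (1 + n)) (s : Bool) where

    vx : HV (6 + n) → V (6 + n)
    vx = cp i s

    fs : Fin (3 + n) → V (6 + n)
    fs j = vx (hf j)

    fs-injective : Injective _≡_ _≡_ fs
    fs-injective refl = refl

    f-d : ∀ j → Adj (fs j) (vx hd)
    f-d j = inj₂ (inH i s (df j))

    f-g : ∀ j → Adj (fs j) (vx hg)
    f-g j = inj₂ (inH i s (gf j))

    d-nbrs g-nbrs : Fin (5 + n) → V (6 + n)
    d-nbrs = vx hc ◂ vx he ◂ fs
    g-nbrs = vx hh ◂ vx hi ◂ fs

    d-pole : L (vx hd) ≡ 0 ⊎ L (vx hd) ≡ 6 + n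
    d-pole = crowded-pole d-nbrs adj (◂-injective (λ { zero () ; (suc j) () }) (◂-injective (λ j ()) fs-injective))
      where
      adj : ∀ j → Adj (d-nbrs j) (vx hd)
      adj zero          = inj₁ (inH i s cd)
      adj (suc zero)    = inj₂ (inH i s de)
      adj (suc (suc j)) = f-d j

    g-pole : L (vx hg) ≡ 0 ⊎ L (vx hg) ≡ 6 + n
    g-pole = crowded-pole g-nbrs adj (◂-injective (λ { zero () ; (suc j) () }) (◂-injective (λ j ()) fs-injective))
      where
      adj : ∀ j → Adj (g-nbrs j) (vx hg)
      adj zero          = inj₁ (inH i s hg)
      adj (suc zero)    = inj₂ (inH i s gi)
      adj (suc (suc j)) = f-g j

    -- d and g share the neighbour f_1, so they are the two different poles.
    d≢g : L (vx hd) ≢ L (vx hg)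
    d≢g = neighbours-distinct (Sum.swap (f-d zero)) (Sum.swap (f-g zero)) λ ()

    c-fs : Fin (4 + n) → V (6 + n)
    c-fs = vx hc ◂ fs

    c-fs-d : ∀ j → Adj (c-fs j) (vx hd)
    c-fs-d zero    = inj₁ (inH i s cd)
    c-fs-d (suc j) = f-d j

    c-fs-injective : Injective _≡_ _≡_ (L ∘ c-fs)
    c-fs-injective = neighbours-injective c-fs c-fs-d (◂-injective (λ j ()) fs-injective)

    -- If d is labelled 0 and g is labelled k, all of c-fs except possibly c lie
    -- in {2, …, k-2}, and there are only k-3 such values.
    c-high : L (vx hd) ≡ 0 → L (vx hg) ≡ 6 + n → 5 + n ≤ L (vx hc)
    c-high d≡0 g≡k with 5 + n ≤? L (vx hc)
    ... | yes k-1≤c = k-1≤c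
    ... | no  k-1≰c = ⊥-elim (crowded-middle (L ∘ c-fs) c-fs-injective
                                (λ j → next-to-0 (Sum.swap (c-fs-d j)) d≡0) high)
      where
      high : ∀ j → L (c-fs j) ≤ 4 + n
      high zero    = ≤-pred (≰⇒> k-1≰c)
      high (suc j) = next-to-k (Sum.swap (f-g j)) g≡k

    c-low : L (vx hd) ≡ 6 + n → L (vx hg) ≡ 0 → L (vx hc) ≤ 1
    c-low d≡k g≡0 with L (vx hc) ≤? 1
    ... | yes c≤1 = c≤1
    ... | no  c≰1 = ⊥-elim (crowded-middle (L ∘ c-fs) c-fs-injective low
                                (λ j → next-to-k (Sum.swap (c-fs-d j)) d≡k))
      where
      low : ∀ j → 2 ≤ L (c-fs j)
      low zero    = ≰⇒> c≰1
      low (suc j) = next-to-0 (Sum.swap (f-g j)) g≡0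

    c-extreme : Extreme n (L (vx hc))
    c-extreme with d-pole | g-pole
    ... | inj₁ d≡0 | inj₁ g≡0 = ⊥-elim (d≢g (trans d≡0 (sym g≡0)))
    ... | inj₂ d≡k | inj₂ g≡k = ⊥-elim (d≢g (trans d≡k (sym g≡k)))
    ... | inj₁ d≡0 | inj₂ g≡k = inj₂ (c-high d≡0 g≡k)
    ... | inj₂ d≡k | inj₁ g≡0 = inj₁ (c-low d≡k g≡0)

  twin-cs-distinct : ∀ i → L (cp i true hc) ≢ L (cp i false hc)
  twin-cs-distinct i = neighbours-distinct (inj₂ (b-c i true)) (inj₂ (b-c i false)) λ ()

  module Hub (Lu : L u ≡ 6 + n) (Lv : L v ≡ 0) where

    B : Fin (1 + n) → ℕ
    B = L ∘ b

    -- If a = 1 and b_i had label k-1, both c's at b_i would be forced to 0.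
    a≡1⇒b≢k-1 : L au ≡ 1 → Avoids B (5 + n)
    a≡1⇒b≢k-1 a≡1 i b≡k-1 = twin-cs-distinct i (trans (c≡0 true) (sym (c≡0 false)))
      where
      c≡0 : ∀ s → L (cp i s hc) ≡ 0
      c≡0 s = extreme-near-k-1 (Gadget.c-extreme i s) (bounded _)
        (λ c≡1 → neighbours-distinct (inj₂ (b-c i s)) (inj₂ (b-au i)) (λ ()) (trans c≡1 (sym a≡1)))
        (subst (λ t → Diff≥2 t (L (cp i s hc))) b≡k-1 (separated (inj₁ (b-c i s))))

    -- If w = k-1 and b_i had label 1, both c's at b_i would be forced to k.
    w≡k-1⇒b≢1 : L av ≡ 5 + n → Avoids B 1
    w≡k-1⇒b≢1 w≡k-1 i b≡1 = twin-cs-distinct i (trans (c≡k true) (sym (c≡k false)))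
      where
      c≡k : ∀ s → L (cp i s hc) ≡ 6 + n
      c≡k s = extreme-near-1 (Gadget.c-extreme i s) (bounded _)
        (λ c≡k-1 → neighbours-distinct (inj₂ (b-c i s)) (inj₂ (b-av i)) (λ ()) (trans c≡k-1 (sym w≡k-1)))
        (subst (λ t → Diff≥2 t (L (cp i s hc))) b≡1 (separated (inj₁ (b-c i s))))

    hub-constraints : HubConstraints n (L au) (L av) B
    hub-constraints = record
      { B-injective    = neighbours-injective b (λ i → inj₁ (b-au i)) λ { refl → refl }
      ; B-bounded      = bounded ∘ b
      ; B-avoids-0     = λ i b≡0 → neighbours-distinct (inj₁ (b-av i)) (inj₂ av-v) (λ ()) (trans b≡0 (sym Lv))
      ; B-avoids-k     = λ i b≡k → neighbours-distinct (inj₁ (b-au i)) (inj₁ u-au) (λ ()) (trans b≡k (sym Lu))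
      ; B-far-a        = λ i → separated (inj₁ (b-au i))
      ; B-far-w        = λ i → separated (inj₁ (b-av i))
      ; a-far-w        = separated (inj₁ au-av)
      ; 1≤a            = n≢0⇒n>0 λ a≡0 → neighbours-distinct (inj₁ au-av) (inj₂ av-v) (λ ()) (trans a≡0 (sym Lv))
      ; a≤k-2          = next-to-k (inj₁ u-au) Lu
      ; 2≤w            = next-to-0 (inj₂ av-v) Lv
      ; w≤k-1          = ≤-pred (≤∧≢⇒< (bounded av)
                           λ w≡k → neighbours-distinct (inj₂ au-av) (inj₁ u-au) (λ ()) (trans w≡k (sym Lu)))
      ; a≡1⇒avoids-k-1 = a≡1⇒b≢k-1
      ; w≡k-1⇒avoids-1 = w≡k-1⇒b≢1
      }

-- A k-L(2,1)-labelling of G_k (k = 6 + n) with L(a_v) = k-1 and L(a_u) = 1: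
-- b_i ↦ 3 + i fills {3, …, k-3}, each f_j ↦ 2 + j fills {2, …, k-2}, and the two
-- copies of H' at b_i use the extreme labels in mirrored fashion.
module Construction (n : ℕ) where

  gadget : Bool → HV (6 + n) → ℕ
  gadget _     (hf j) = 2 + toℕ j
  gadget true  hc     = 0
  gadget true  hd     = 6 + n
  gadget true  he     = 1
  gadget true  hg     = 0
  gadget true  hh     = 5 + n
  gadget true  hi     = 6 + n
  gadget false hc     = 6 + n
  gadget false hd     = 0
  gadget false he     = 5 + n
  gadget false hg     = 6 + n
  gadget false hh     = 0
  gadget false hi     = 1

  L : V (6 + n) → ℕ
  L u          = 6 + n
  L au         = 1
  L av         = 5 + n
  L v          = 0
  L (b i)      = 3 + toℕ i
  L (cp _ s h) = gadget s h

  i≤n : (i : Fin (1 + n)) → toℕ i ≤ n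
  i≤n i = ≤-pred (Fin.toℕ<n i)

  j≤n+2 : (j : Fin (3 + n)) → toℕ j ≤ 2 + n
  j≤n+2 j = ≤-pred (Fin.toℕ<n j)

  b<k-1 : ∀ i → 3 + toℕ i < 5 + n
  b<k-1 i = m<n⇒m<1+n (+-monoʳ-≤ 4 (i≤n i))

  f<k-1 : ∀ j → 2 + toℕ j < 5 + n
  f<k-1 j = +-monoʳ-≤ 3 (j≤n+2 j)

  b≢k-1 : ∀ i → 3 + toℕ i ≢ 5 + n
  b≢k-1 = <⇒≢ ∘ b<k-1

  b≢k : ∀ i → 3 + toℕ i ≢ 6 + n
  b≢k = <⇒≢ ∘ m<n⇒m<1+n ∘ b<k-1

  f≢k-1 : ∀ j → 2 + toℕ j ≢ 5 + n
  f≢k-1 = <⇒≢ ∘ f<k-1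

  f≢k : ∀ j → 2 + toℕ j ≢ 6 + n
  f≢k = <⇒≢ ∘ m<n⇒m<1+n ∘ f<k-1

  bounded : ∀ x → L x ≤ 6 + n
  bounded u               = ≤-refl
  bounded au              = s≤s z≤n
  bounded av              = n≤1+n _
  bounded v               = z≤n
  bounded (b i)           = +-monoʳ-≤ 3 (≤-trans (i≤n i) (m≤n+m n 3))
  bounded (cp _ _ (hf j)) = +-monoʳ-≤ 2 (≤-trans (j≤n+2 j) (m≤n+m (2 + n) 2))
  bounded (cp _ true  hc) = z≤n
  bounded (cp _ true  hd) = ≤-refl
  bounded (cp _ true  he) = s≤s z≤n
  bounded (cp _ true  hg) = z≤n
  bounded (cp _ true  hh) = n≤1+n _
  bounded (cp _ true  hi) = ≤-refl
  bounded (cp _ false hc) = ≤-refl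
  bounded (cp _ false hd) = z≤n
  bounded (cp _ false he) = n≤1+n _
  bounded (cp _ false hg) = ≤-refl
  bounded (cp _ false hh) = z≤n
  bounded (cp _ false hi) = s≤s z≤n

  edge-separated : ∀ {x y} → E x y → Diff≥2 (L x) (L y)
  edge-separated u-au                  = inj₂ (m≤m+n 3 _)
  edge-separated au-av                 = inj₁ (m≤m+n 3 _)
  edge-separated av-v                  = inj₂ (m≤m+n 2 _)
  edge-separated (b-au i)              = inj₂ (m≤m+n 3 _)
  edge-separated (b-av i)              = inj₁ (+-monoʳ-≤ 5 (i≤n i))
  edge-separated (b-c i true)          = inj₂ (m≤m+n 2 _)
  edge-separated (b-c i false)         = inj₁ (+-monoʳ-≤ 5 (m≤n⇒m≤1+n (i≤n i)))
  edge-separated (inH i true  cd)      = inj₁ (m≤m+n 2 _)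
  edge-separated (inH i true  de)      = inj₂ (m≤m+n 3 _)
  edge-separated (inH i true  hg)      = inj₂ (m≤m+n 2 _)
  edge-separated (inH i true  gi)      = inj₁ (m≤m+n 2 _)
  edge-separated (inH i true  (gf j))  = inj₁ (m≤m+n 2 _)
  edge-separated (inH i true  (df j))  = inj₂ (+-monoʳ-≤ 4 (j≤n+2 j))
  edge-separated (inH i false cd)      = inj₂ (m≤m+n 2 _)
  edge-separated (inH i false de)      = inj₁ (m≤m+n 2 _)
  edge-separated (inH i false hg)      = inj₁ (m≤m+n 2 _)
  edge-separated (inH i false gi)      = inj₂ (m≤m+n 3 _)
  edge-separated (inH i false (gf j))  = inj₂ (+-monoʳ-≤ 4 (j≤n+2 j))
  edge-separated (inH i false (df j))  = inj₁ (m≤m+n 2 _)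

  f-injective : ∀ {j j′ : Fin (3 + n)} → 2 + toℕ j ≡ 2 + toℕ j′ → hf {6 + n} j ≡ hf j′
  f-injective eq = cong hf (Fin.toℕ-injective (suc-injective (suc-injective eq)))

  b-injective : ∀ {i i′ : Fin (1 + n)} → 3 + toℕ i ≡ 3 + toℕ i′ → b {6 + n} i ≡ b i′
  b-injective eq = cong b (Fin.toℕ-injective (suc-injective (suc-injective (suc-injective eq))))

  HAdj : HV (6 + n) → HV (6 + n) → Set
  HAdj x z = HE x z ⊎ HE z x

  gadget-injective : ∀ s {x y z} → HAdj x z → HAdj y z → gadget s x ≡ gadget s y → x ≡ y
  gadget-injective _ (inj₁ cd)     (inj₁ cd)      _  = refl
  gadget-injective _ (inj₂ cd)     (inj₂ cd)      _  = refl
  gadget-injective _ (inj₁ de)     (inj₁ de)      _  = refl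
  gadget-injective _ (inj₂ de)     (inj₂ de)      _  = refl
  gadget-injective _ (inj₁ hg)     (inj₁ hg)      _  = refl
  gadget-injective _ (inj₂ hg)     (inj₂ hg)      _  = refl
  gadget-injective _ (inj₁ gi)     (inj₁ gi)      _  = refl
  gadget-injective _ (inj₂ gi)     (inj₂ gi)      _  = refl
  gadget-injective _ (inj₁ (df j)) (inj₁ (df j))  _  = refl
  gadget-injective _ (inj₁ (gf j)) (inj₁ (gf j))  _  = refl
  gadget-injective _ (inj₂ (df j)) (inj₂ (df j′)) eq = f-injective eq
  gadget-injective _ (inj₂ (gf j)) (inj₂ (gf j′)) eq = f-injective eq
  gadget-injective true  (inj₁ cd)     (inj₂ de)     ()
  gadget-injective false (inj₁ cd)     (inj₂ de)     ()
  gadget-injective true  (inj₂ de)     (inj₁ cd)     ()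
  gadget-injective false (inj₂ de)     (inj₁ cd)     ()
  gadget-injective true  (inj₁ cd)     (inj₂ (df j)) ()
  gadget-injective false (inj₁ cd)     (inj₂ (df j)) eq = ⊥-elim (f≢k j (sym eq))
  gadget-injective true  (inj₂ (df j)) (inj₁ cd)     ()
  gadget-injective false (inj₂ (df j)) (inj₁ cd)     eq = ⊥-elim (f≢k j eq)
  gadget-injective true  (inj₂ de)     (inj₂ (df j)) ()
  gadget-injective false (inj₂ de)     (inj₂ (df j)) eq = ⊥-elim (f≢k-1 j (sym eq))
  gadget-injective true  (inj₂ (df j)) (inj₂ de)     ()
  gadget-injective false (inj₂ (df j)) (inj₂ de)     eq = ⊥-elim (f≢k-1 j eq)
  gadget-injective true  (inj₁ (df j)) (inj₁ (gf j)) ()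
  gadget-injective false (inj₁ (df j)) (inj₁ (gf j)) ()
  gadget-injective true  (inj₁ (gf j)) (inj₁ (df j)) ()
  gadget-injective false (inj₁ (gf j)) (inj₁ (df j)) ()
  gadget-injective true  (inj₁ hg)     (inj₂ gi)     ()
  gadget-injective false (inj₁ hg)     (inj₂ gi)     ()
  gadget-injective true  (inj₂ gi)     (inj₁ hg)     ()
  gadget-injective false (inj₂ gi)     (inj₁ hg)     ()
  gadget-injective true  (inj₁ hg)     (inj₂ (gf j)) eq = ⊥-elim (f≢k-1 j (sym eq))
  gadget-injective false (inj₁ hg)     (inj₂ (gf j)) ()
  gadget-injective true  (inj₂ (gf j)) (inj₁ hg)     eq = ⊥-elim (f≢k-1 j eq)
  gadget-injective false (inj₂ (gf j)) (inj₁ hg)     ()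
  gadget-injective true  (inj₂ gi)     (inj₂ (gf j)) eq = ⊥-elim (f≢k j (sym eq))
  gadget-injective false (inj₂ gi)     (inj₂ (gf j)) ()
  gadget-injective true  (inj₂ (gf j)) (inj₂ gi)     eq = ⊥-elim (f≢k j eq)
  gadget-injective false (inj₂ (gf j)) (inj₂ gi)     ()

  neighbour-injective : ∀ {x y z} → Adj x z → Adj y z → L x ≡ L y → x ≡ y
  neighbour-injective (inj₂ u-au)      (inj₂ u-au)       _  = refl
  neighbour-injective (inj₁ av-v)      (inj₁ av-v)       _  = refl
  neighbour-injective (inj₁ u-au)      (inj₁ u-au)       _  = refl
  neighbour-injective (inj₂ au-av)     (inj₂ au-av)      _  = refl
  neighbour-injective (inj₁ (b-au i))  (inj₁ (b-au i′))  eq = b-injective eq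
  neighbour-injective (inj₁ u-au)      (inj₂ au-av)      ()
  neighbour-injective (inj₂ au-av)     (inj₁ u-au)       ()
  neighbour-injective (inj₁ u-au)      (inj₁ (b-au i))   eq = ⊥-elim (b≢k i (sym eq))
  neighbour-injective (inj₁ (b-au i))  (inj₁ u-au)       eq = ⊥-elim (b≢k i eq)
  neighbour-injective (inj₂ au-av)     (inj₁ (b-au i))   eq = ⊥-elim (b≢k-1 i (sym eq))
  neighbour-injective (inj₁ (b-au i))  (inj₂ au-av)      eq = ⊥-elim (b≢k-1 i eq)
  neighbour-injective (inj₁ au-av)     (inj₁ au-av)      _  = refl
  neighbour-injective (inj₂ av-v)      (inj₂ av-v)       _  = refl
  neighbour-injective (inj₁ (b-av i))  (inj₁ (b-av i′))  eq = b-injective eq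
  neighbour-injective (inj₁ au-av)     (inj₂ av-v)       ()
  neighbour-injective (inj₂ av-v)      (inj₁ au-av)      ()
  neighbour-injective (inj₁ au-av)     (inj₁ (b-av i))   ()
  neighbour-injective (inj₁ (b-av i))  (inj₁ au-av)      ()
  neighbour-injective (inj₂ av-v)      (inj₁ (b-av i))   ()
  neighbour-injective (inj₁ (b-av i))  (inj₂ av-v)       ()
  neighbour-injective (inj₂ (b-au i))       (inj₂ (b-au i))       _ = refl
  neighbour-injective (inj₂ (b-av i))       (inj₂ (b-av i))       _ = refl
  neighbour-injective (inj₂ (b-c i true))   (inj₂ (b-c i true))   _ = refl
  neighbour-injective (inj₂ (b-c i false))  (inj₂ (b-c i false))  _ = refl
  neighbour-injective (inj₂ (b-c i true))   (inj₂ (b-c i false))  ()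
  neighbour-injective (inj₂ (b-c i false))  (inj₂ (b-c i true))   ()
  neighbour-injective (inj₂ (b-au i))       (inj₂ (b-av i))       ()
  neighbour-injective (inj₂ (b-av i))       (inj₂ (b-au i))       ()
  neighbour-injective (inj₂ (b-au i))       (inj₂ (b-c i true))   ()
  neighbour-injective (inj₂ (b-au i))       (inj₂ (b-c i false))  ()
  neighbour-injective (inj₂ (b-c i true))   (inj₂ (b-au i))       ()
  neighbour-injective (inj₂ (b-c i false))  (inj₂ (b-au i))       ()
  neighbour-injective (inj₂ (b-av i))       (inj₂ (b-c i true))   ()
  neighbour-injective (inj₂ (b-av i))       (inj₂ (b-c i false))  ()
  neighbour-injective (inj₂ (b-c i true))   (inj₂ (b-av i))       ()
  neighbour-injective (inj₂ (b-c i false))  (inj₂ (b-av i))       ()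
  neighbour-injective (inj₁ (b-c i s))            (inj₁ (b-c i s))            _  = refl
  neighbour-injective (inj₁ (b-c i true))         (inj₂ (inH i true cd))      eq = ⊥-elim (b≢k i eq)
  neighbour-injective (inj₁ (b-c i false))        (inj₂ (inH i false cd))     ()
  neighbour-injective (inj₂ (inH i true cd))      (inj₁ (b-c i true))         eq = ⊥-elim (b≢k i (sym eq))
  neighbour-injective (inj₂ (inH i false cd))     (inj₁ (b-c i false))        ()
  neighbour-injective (inj₁ (inH i s e)) (inj₁ (inH i s e′)) eq = cong (cp i s) (gadget-injective s (inj₁ e) (inj₁ e′) eq)
  neighbour-injective (inj₁ (inH i s e)) (inj₂ (inH i s e′)) eq = cong (cp i s) (gadget-injective s (inj₁ e) (inj₂ e′) eq)
  neighbour-injective (inj₂ (inH i s e)) (inj₁ (inH i s e′)) eq = cong (cp i s) (gadget-injective s (inj₂ e) (inj₁ e′) eq)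
  neighbour-injective (inj₂ (inH i s e)) (inj₂ (inH i s e′)) eq = cong (cp i s) (gadget-injective s (inj₂ e) (inj₂ e′) eq)

  isL21 : IsL21 (6 + n) L
  isL21 = bounded
        , (λ { _ _ (inj₁ e) → edge-separated e ; _ _ (inj₂ e) → Sum.swap (edge-separated e) })
        , λ { _ _ (x≢y , _ , _ , xz , zy) → x≢y ∘ neighbour-injective xz (Sum.swap zy) }

lemma9 : (k : ℕ) → 6 ≤ k → (x y : ℤ) →
    (Σ (V k → ℕ) (λ L → IsL21 k L × L u ≡ k × L v ≡ 0 × + L av ≡ x × + L au ≡ y))
      ⇔ (x ≡ + (k ∸ 1) × y ≡ + 1)
lemma9 _ (s≤s (s≤s (s≤s (s≤s (s≤s (s≤s (z≤n {n}))))))) x y = mk⇔ forced realised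
  where
  forced : Σ (V (6 + n) → ℕ) (λ L → IsL21 (6 + n) L × L u ≡ 6 + n × L v ≡ 0 × + L av ≡ x × + L au ≡ y) →
           x ≡ + (5 + n) × y ≡ + 1
  forced (L , isL , Lu , Lv , refl , refl) with hub-forced (Labelling.Hub.hub-constraints n L isL Lu Lv)
  ... | a≡1 , w≡k-1 = cong +_ w≡k-1 , cong +_ a≡1

  realised : x ≡ + (5 + n) × y ≡ + 1 →
             Σ (V (6 + n) → ℕ) (λ L → IsL21 (6 + n) L × L u ≡ 6 + n × L v ≡ 0 × + L av ≡ x × + L au ≡ y)
  realised (refl , refl) = Construction.L n , Construction.isL21 n , refl , refl , refl , refl
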